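{- Let $n\ge 3$ and consider the $n$-stage binary linear feedback shift register with feedback function $F(x_1,\ldots,x_n)=x_{n-1}+x_n$ over $GF(2)$. Then its state diagram $G_F$ has exactly two connected components $G_1$ and $G_2$, where $G_1$ contains the loop at the all-zero state $\mathbf{0}^n=(0,\ldots,0)$ (the cycle $[0]$), and $G_2$ contains the cycle of length $3$ denoted $[0,1,1]$, i.e. the cycle $v_1\to v_2\to v_3\to v_1$ with $v_1=(0,1,1,0,1,1,\ldots)$, $v_2=(1,1,0,1,1,0,\ldots)$, $v_3=(1,0,1,1,0,1,\ldots)$ (the first $n$ terms of the respective periodic sequences).
   Context: An $n$-stage feedback shift register (FSR) with feedback function $F:GF(2)^n\to GF(2)$ maps a state $(a_1,\ldots,a_n)\in GF(2)^n$ to its successor $(a_2,\ldots,a_n,F(a_1,\ldots,a_n))$. Its state diagram $G_F$ is the directed graph on vertex set $GF(2)^n$ with an arc from each state to its successor. Connected components are taken in the underlying undirected graph. A cycle written as a ring sequence $[y_1,\ldots,y_k]$ denotes the cycle of $k$ distinct states $Y_1\to Y_2\to\cdots\to Y_k\to Y_1$ in $G_F$, where $y_i$ is the first coordinate of $Y_i$; $[0]$ is the loop at $\mathbf{0}^n$. -}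

module Defs where

open import Data.Nat using (ℕ; zero; suc; _%_)
open import Data.Bool using (Bool; true; false; _xor_; not)
open import Data.Fin using (Fin; toℕ)
open import Data.Vec using (Vec; []; _∷_; _∷ʳ_; tabulate; replicate)
open import Relation.Binary.PropositionalEquality using (_≡_)
open import Relation.Binary.Construct.Closure.Equivalence using (EqClosure)

-- States of an n-stage binary FSR: (a₁,…,aₙ) ∈ GF(2)ⁿ, GF(2) = Bool with xor as +.
State : ℕ → Set
State n = Vec Bool n

succF : ∀ {n} → (State (suc n) → Bool) → State (suc n) → State (suc n)
succF F (a ∷ as) = as ∷ʳ F (a ∷ as)

lastTwoSum : ∀ {k} → State (suc (suc k)) → Bool
lastTwoSum {zero} (x ∷ y ∷ []) = x xor y
lastTwoSum {suc k} (x ∷ xs) = lastTwoSum xs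

Arc : ∀ {n} → (State (suc n) → Bool) → State (suc n) → State (suc n) → Set
Arc F x y = succF F x ≡ y

Connected : ∀ {n} → (State (suc n) → Bool) → State (suc n) → State (suc n) → Set
Connected F = EqClosure (Arc F)

zeroState : ∀ n → State n
zeroState n = replicate n false

v₁ v₂ v₃ : ∀ n → State n
v₁ n = tabulate (λ (i : Fin n) → not (toℕ i % 3 ≡ᵇ 0))
  where open import Data.Nat using (_≡ᵇ_)
v₂ n = tabulate (λ (i : Fin n) → not (toℕ i % 3 ≡ᵇ 2))
  where open import Data.Nat using (_≡ᵇ_)
v₃ n = tabulate (λ (i : Fin n) → not (toℕ i % 3 ≡ᵇ 1))
  where open import Data.Nat using (_≡ᵇ_)

-- Each step shifts the state left and appends the sum of its last two entries, so
-- after n steps every entry obeys the Fibonacci recurrence a_{i+2} = a_i + a_{i+1}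
-- over GF(2). Such a state is determined by its first two bits: it is 0ⁿ or one of
-- the three states of [0,1,1]. Conversely, the last two bits evolve by the
-- permutation (a, b) ↦ (b, a + b), which fixes (0, 0), so "the last two bits are
-- zero" is constant on components and separates 0ⁿ from v₁.
module Submission where

open import Defs
open import Data.Nat using (ℕ; zero; suc; _+_; _%_; _≡ᵇ_)
open import Data.Bool using (Bool; true; false; _xor_; not; _∨_)
open import Data.Unit using (⊤; tt)
open import Data.Product using (_×_; _,_; ∃; ∃₂)
open import Data.Sum as Sum using (_⊎_; inj₁; inj₂)
open import Data.Fin using (toℕ)
open import Data.Vec using (Vec; []; _∷_; _∷ʳ_)
open import Data.Vec.Properties using (tabulate-cong)
open import Relation.Nullary using (¬_)
open import Relation.Binary.PropositionalEquality
  using (_≡_; _≢_; refl; sym; trans; cong; subst; subst₂; isEquivalence; module ≡-Reasoning)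
open import Relation.Binary.Construct.Closure.ReflexiveTransitive using (ε; _◅_; _◅◅_)
open import Relation.Binary.Construct.Closure.Symmetric using (fwd; bwd)
open import Relation.Binary.Construct.Closure.Equivalence using (gfold)

fibonacci : ∀ n → Bool → Bool → Vec Bool n
fibonacci zero    p q = []
fibonacci (suc n) p q = p ∷ fibonacci n q (p xor q)

IsFibonacci : ∀ {n} → Vec Bool n → Set
IsFibonacci (a ∷ b ∷ c ∷ xs) = (c ≡ a xor b) × IsFibonacci (b ∷ c ∷ xs)
IsFibonacci _                = ⊤

IsFibonacciAfter : ∀ {n} → ℕ → Vec Bool n → Set
IsFibonacciAfter zero    xs       = IsFibonacci xs
IsFibonacciAfter (suc k) []       = ⊤
IsFibonacciAfter (suc k) (x ∷ xs) = IsFibonacciAfter k xs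

fibonacci-isFibonacci : ∀ n p q → IsFibonacci (fibonacci n p q)
fibonacci-isFibonacci zero                p q = tt
fibonacci-isFibonacci (suc zero)          p q = tt
fibonacci-isFibonacci (suc (suc zero))    p q = tt
fibonacci-isFibonacci (suc (suc (suc n))) p q =
  refl , fibonacci-isFibonacci (suc (suc n)) q (p xor q)

isFibonacci⇒≡fibonacci : ∀ {n} a b (xs : Vec Bool n) →
  IsFibonacci (a ∷ b ∷ xs) → a ∷ b ∷ xs ≡ fibonacci (suc (suc n)) a b
isFibonacci⇒≡fibonacci a b []       _            = refl
isFibonacci⇒≡fibonacci a b (c ∷ xs) (refl , fib) =
  cong (a ∷_) (isFibonacci⇒≡fibonacci b c xs fib)

isFibonacci⇒isFibonacciAfter : ∀ {n} k (xs : Vec Bool n) →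
  IsFibonacci xs → IsFibonacciAfter k xs
isFibonacci⇒isFibonacciAfter zero    xs                fib       = fib
isFibonacci⇒isFibonacciAfter (suc k) []                _         = tt
isFibonacci⇒isFibonacciAfter (suc k) (a ∷ [])          _         = isFibonacci⇒isFibonacciAfter k [] tt
isFibonacci⇒isFibonacciAfter (suc k) (a ∷ b ∷ [])      _         = isFibonacci⇒isFibonacciAfter k (b ∷ []) tt
isFibonacci⇒isFibonacciAfter (suc k) (a ∷ b ∷ c ∷ xs) (_ , fib) = isFibonacci⇒isFibonacciAfter k (b ∷ c ∷ xs) fib

isFibonacciAfter-length : ∀ {n} (xs : Vec Bool n) → IsFibonacciAfter n xs
isFibonacciAfter-length []       = tt
isFibonacciAfter-length (x ∷ xs) = isFibonacciAfter-length xs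

isFibonacci-∷ʳ-lastTwoSum : ∀ {n} (xs : State (suc (suc n))) →
  IsFibonacci xs → IsFibonacci (xs ∷ʳ lastTwoSum xs)
isFibonacci-∷ʳ-lastTwoSum (a ∷ b ∷ [])     _         = refl , tt
isFibonacci-∷ʳ-lastTwoSum (a ∷ b ∷ c ∷ xs) (e , fib) = e , isFibonacci-∷ʳ-lastTwoSum (b ∷ c ∷ xs) fib

isFibonacciAfter-∷ʳ-lastTwoSum : ∀ {n} k (xs : State (suc (suc n))) →
  IsFibonacciAfter k xs → IsFibonacciAfter k (xs ∷ʳ lastTwoSum xs)
isFibonacciAfter-∷ʳ-lastTwoSum zero    xs               fib = isFibonacci-∷ʳ-lastTwoSum xs fib
isFibonacciAfter-∷ʳ-lastTwoSum (suc k) (a ∷ b ∷ [])     _   =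
  isFibonacci⇒isFibonacciAfter k (b ∷ (a xor b) ∷ []) tt
isFibonacciAfter-∷ʳ-lastTwoSum (suc k) (a ∷ b ∷ c ∷ xs) fib =
  isFibonacciAfter-∷ʳ-lastTwoSum k (b ∷ c ∷ xs) fib

succF-fibonacci : ∀ m p q →
  succF lastTwoSum (fibonacci (3 + m) p q) ≡ fibonacci (3 + m) q (p xor q)
succF-fibonacci m p q = isFibonacci⇒≡fibonacci q (p xor q) _
  (isFibonacci-∷ʳ-lastTwoSum (fibonacci (2 + m) q (p xor q))
                              (fibonacci-isFibonacci (2 + m) q (p xor q)))

fibonacci-zeroState : ∀ n → fibonacci n false false ≡ zeroState n
fibonacci-zeroState zero    = refl
fibonacci-zeroState (suc n) = cong (false ∷_) (fibonacci-zeroState n)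

suc%3≡ᵇ0 : ∀ k → (suc k % 3 ≡ᵇ 0) ≡ (k % 3 ≡ᵇ 2)
suc%3≡ᵇ0 0                   = refl
suc%3≡ᵇ0 1                   = refl
suc%3≡ᵇ0 2                   = refl
suc%3≡ᵇ0 (suc (suc (suc k))) = suc%3≡ᵇ0 k

suc%3≡ᵇ1 : ∀ k → (suc k % 3 ≡ᵇ 1) ≡ (k % 3 ≡ᵇ 0)
suc%3≡ᵇ1 0                   = refl
suc%3≡ᵇ1 1                   = refl
suc%3≡ᵇ1 2                   = refl
suc%3≡ᵇ1 (suc (suc (suc k))) = suc%3≡ᵇ1 k

suc%3≡ᵇ2 : ∀ k → (suc k % 3 ≡ᵇ 2) ≡ (k % 3 ≡ᵇ 1)
suc%3≡ᵇ2 0                   = refl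
suc%3≡ᵇ2 1                   = refl
suc%3≡ᵇ2 2                   = refl
suc%3≡ᵇ2 (suc (suc (suc k))) = suc%3≡ᵇ2 k

fibonacci-v₁ : ∀ n → fibonacci n false true ≡ v₁ n
fibonacci-v₂ : ∀ n → fibonacci n true true ≡ v₂ n
fibonacci-v₃ : ∀ n → fibonacci n true false ≡ v₃ n
fibonacci-v₁ zero    = refl
fibonacci-v₁ (suc n) = cong (false ∷_)
  (trans (fibonacci-v₂ n) (tabulate-cong (λ i → cong not (sym (suc%3≡ᵇ0 (toℕ i))))))
fibonacci-v₂ zero    = refl
fibonacci-v₂ (suc n) = cong (true ∷_)
  (trans (fibonacci-v₃ n) (tabulate-cong (λ i → cong not (sym (suc%3≡ᵇ2 (toℕ i))))))
fibonacci-v₃ zero    = refl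
fibonacci-v₃ (suc n) = cong (true ∷_)
  (trans (fibonacci-v₁ n) (tabulate-cong (λ i → cong not (sym (suc%3≡ᵇ1 (toℕ i))))))

connected-succF : ∀ {n} (F : State (suc n) → Bool) (x : State (suc n)) →
  Connected F x (succF F x)
connected-succF F x = fwd refl ◅ ε

connected-isFibonacci : ∀ {m} k (x : State (3 + m)) → IsFibonacciAfter k x →
  ∃ λ z → IsFibonacci z × Connected lastTwoSum x z
connected-isFibonacci zero    x          fib = x , fib , ε
connected-isFibonacci (suc k) x@(a ∷ xs) fib
  with connected-isFibonacci k (succF lastTwoSum x) (isFibonacciAfter-∷ʳ-lastTwoSum k xs fib)
... | z , fib-z , x~z = z , fib-z , connected-succF lastTwoSum x ◅◅ x~z

connected-fibonacci : ∀ {m} (x : State (3 + m)) →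
  ∃₂ λ p q → Connected lastTwoSum x (fibonacci (3 + m) p q)
connected-fibonacci {m} x with connected-isFibonacci (3 + m) x (isFibonacciAfter-length x)
... | p ∷ q ∷ zs , fib , x~z = p , q , subst (Connected lastTwoSum x) (isFibonacci⇒≡fibonacci p q zs fib) x~z

Connected⇒≡ : ∀ {n a} {A : Set a} (F : State (suc n) → Bool) (g : State (suc n) → A) →
  (∀ x → g (succF F x) ≡ g x) → ∀ {x y} → Connected F x y → g x ≡ g y
Connected⇒≡ F g g-invariant = gfold isEquivalence g (λ {x} arc → trans (sym (g-invariant x)) (cong g arc))

lastTwoZero : ∀ {k} → State (suc (suc k)) → Bool
lastTwoZero {zero}  (x ∷ y ∷ []) = not (x ∨ y)
lastTwoZero {suc k} (x ∷ xs)     = lastTwoZero xs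

∨-xor≡∨ : ∀ p q → q ∨ (p xor q) ≡ p ∨ q
∨-xor≡∨ false false = refl
∨-xor≡∨ false true  = refl
∨-xor≡∨ true  false = refl
∨-xor≡∨ true  true  = refl

lastTwoZero-∷ʳ-lastTwoSum : ∀ {n} (xs : State (suc (suc n))) →
  lastTwoZero (xs ∷ʳ lastTwoSum xs) ≡ lastTwoZero xs
lastTwoZero-∷ʳ-lastTwoSum (a ∷ b ∷ [])     = cong not (∨-xor≡∨ a b)
lastTwoZero-∷ʳ-lastTwoSum (a ∷ b ∷ c ∷ xs) = lastTwoZero-∷ʳ-lastTwoSum (b ∷ c ∷ xs)

lastTwoZero-succF : ∀ {m} (x : State (3 + m)) → lastTwoZero (succF lastTwoSum x) ≡ lastTwoZero x
lastTwoZero-succF (a ∷ xs) = lastTwoZero-∷ʳ-lastTwoSum xs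

lastTwoZero-fibonacci : ∀ n p q → lastTwoZero (fibonacci (2 + n) p q) ≡ not (p ∨ q)
lastTwoZero-fibonacci zero    p q = refl
lastTwoZero-fibonacci (suc n) p q = trans (lastTwoZero-fibonacci n q (p xor q)) (cong not (∨-xor≡∨ p q))

fibonacci-component : ∀ m p q →
    Connected lastTwoSum (fibonacci (3 + m) p q) (fibonacci (3 + m) false false)
  ⊎ Connected lastTwoSum (fibonacci (3 + m) p q) (fibonacci (3 + m) false true)
fibonacci-component m false false = inj₁ ε
fibonacci-component m false true  = inj₂ ε
fibonacci-component m true  true  = inj₂ (bwd (succF-fibonacci m false true) ◅ ε)
fibonacci-component m true  false = inj₂ (fwd (succF-fibonacci m true false) ◅ ε)

connected-zeroState⊎v₁ : ∀ m (x : State (3 + m)) →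
  Connected lastTwoSum x (zeroState (3 + m)) ⊎ Connected lastTwoSum x (v₁ (3 + m))
connected-zeroState⊎v₁ m x with connected-fibonacci x
... | p , q , x~z = Sum.map (λ z~0 → subst (Connected lastTwoSum x) (fibonacci-zeroState (3 + m)) (x~z ◅◅ z~0))
                            (λ z~v → subst (Connected lastTwoSum x) (fibonacci-v₁ (3 + m)) (x~z ◅◅ z~v))
                            (fibonacci-component m p q)

¬connected-zeroState-v₁ : ∀ m → ¬ Connected lastTwoSum (zeroState (3 + m)) (v₁ (3 + m))
¬connected-zeroState-v₁ m 0~v₁ with true≡false
  where
  open ≡-Reasoning
  true≡false : true ≡ false
  true≡false = begin
    true                                        ≡⟨ sym (lastTwoZero-fibonacci (suc m) false false) ⟩
    lastTwoZero (fibonacci (3 + m) false false) ≡⟨ cong lastTwoZero (fibonacci-zeroState (3 + m)) ⟩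
    lastTwoZero (zeroState (3 + m))             ≡⟨ Connected⇒≡ lastTwoSum lastTwoZero lastTwoZero-succF 0~v₁ ⟩
    lastTwoZero (v₁ (3 + m))                    ≡⟨ cong lastTwoZero (sym (fibonacci-v₁ (3 + m))) ⟩
    lastTwoZero (fibonacci (3 + m) false true)  ≡⟨ lastTwoZero-fibonacci (suc m) false true ⟩
    false                                       ∎
... | ()

theorem3 : (m : ℕ) →
    let n = 3 + m in
      (succF lastTwoSum (zeroState n) ≡ zeroState n)
    × (succF lastTwoSum (v₁ n) ≡ v₂ n)
    × (succF lastTwoSum (v₂ n) ≡ v₃ n)
    × (succF lastTwoSum (v₃ n) ≡ v₁ n)
    × (v₁ n ≢ v₂ n) × (v₂ n ≢ v₃ n) × (v₁ n ≢ v₃ n)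
    × ((x : State n) → Connected lastTwoSum x (zeroState n) ⊎ Connected lastTwoSum x (v₁ n))
    × ¬ Connected lastTwoSum (zeroState n) (v₁ n)
theorem3 m =
    subst₂ arc (fibonacci-zeroState n) (fibonacci-zeroState n) (succF-fibonacci m false false)
  , subst₂ arc (fibonacci-v₁ n) (fibonacci-v₂ n) (succF-fibonacci m false true)
  , subst₂ arc (fibonacci-v₂ n) (fibonacci-v₃ n) (succF-fibonacci m true true)
  , subst₂ arc (fibonacci-v₃ n) (fibonacci-v₁ n) (succF-fibonacci m true false)
  , (λ ()) , (λ ()) , (λ ())
  , connected-zeroState⊎v₁ m
  , ¬connected-zeroState-v₁ m
  where
  n = 3 + m
  arc : State n → State n → Set
  arc = Arc lastTwoSum
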